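{- Let $H$ be a graph possibly with loops, let $G$ be a finite multigraph without loops with an $H$-coloring $c$, and let $M_J$ be the joint matching of $L_2^H(G)$. There exists a perfect matching $M$ of $L_2^H(G)\setminus M_J$ (the graph $L_2^H(G)$ with the edges of $M_J$ deleted) if and only if there exists a partition of the edges of $G$ into closed dynamic $H$-trails (some of which may be of the form $(x,e_0,\ldots,e_k,y)$ with $k\ge 1$).
   Context: An $H$-coloring of $G$ is a map $c:E(G)\to V(H)$. Two distinct edges of $G$ are parallel if they have the same two end vertices. A dynamic $H$-walk in $G$ is a sequence $W=(v_0,e_0^1,\ldots,e_0^{k_0},v_1,e_1^1,\ldots,v_{n-1},e_{n-1}^1,\ldots,e_{n-1}^{k_{n-1}},v_n)$ with $n\ge1$, $k_i\ge 1$, each $e_i^j$ an edge joining $v_i$ and $v_{i+1}$, such that $c(e_i^{k_i})c(e_{i+1}^1)\in E(H)$ for each $i\in\{0,\ldots,n-2\}$. A dynamic $H$-trail is one with no repeated edge; it is closed if either $v_0=v_n$ and $c(e_{n-1}^{k_{n-1}})c(e_0^1)\in E(H)$, or $v_1=v_n$ and $e_{n-1}^{k_{n-1}}$ and $e_0^1$ are parallel. A partition of the edges into closed dynamic $H$-trails means a family of closed dynamic $H$-trails whose edge sets partition $E(G)$. $L_2^H(G)$ is the simple graph with vertex set $\{f(x,e): e\in E(G),\ x \text{ an end of } e\}$, in which $f(x,e)f(y,e)$ is an edge for every edge $e$ of $G$ with ends $x,y$; $f(u,e)$ and $f(u,g)$ are adjacent iff $e\ne g$ and $c(e)c(g)\in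 E(H)$; and $f(u,e),f(v,g)$ with $u\ne v$ are adjacent iff $e,g$ are distinct parallel edges; there are no other edges. The joint matching is $M_J=\{f(x,e)f(y,e): e\in E(G)\text{ with ends }x,y\}$. -}

module Defs where

open import Data.Nat using (ℕ)
open import Data.Fin using (Fin)
open import Data.Bool using (Bool; true; false)
open import Data.Product using (Σ; ∃; _×_; _,_; proj₁; proj₂)
open import Data.Sum using (_⊎_)
open import Data.Empty using (⊥)
open import Data.List using (List; []; _∷_; concatMap; allFin)
open import Data.List.NonEmpty using (List⁺; _∷_; head; last; toList)
open import Data.List.Relation.Unary.All using (All)
open import Data.List.Relation.Unary.Unique.Propositional using (Unique)
open import Data.List.Relation.Binary.Permutation.Propositional using (_↭_)
open import Relation.Nullary using (¬_)
open import Relation.Binary.PropositionalEquality using (_≡_; _≢_)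

record GraphWithLoops : Set₁ where
  field
    V   : Set
    Adj : V → V → Set
    sym : ∀ {a b} → Adj a b → Adj b a

record LooplessMultigraph : Set where
  field
    nV  : ℕ
    nE  : ℕ
    src : Fin nE → Fin nV
    tgt : Fin nE → Fin nV
    loopless : ∀ e → src e ≢ tgt e

record PerfectMatching {V : Set} (A : V → V → Set) : Set₁ where
  field
    M     : V → V → Set
    M-sym : ∀ {p q} → M p q → M q p
    M⊆A   : ∀ {p q} → M p q → A p q
    cover : ∀ p → ∃ λ q → M p q × (∀ q' → M p q' → q' ≡ q)

module _ (H : GraphWithLoops) (G : LooplessMultigraph)
         (c : Fin (LooplessMultigraph.nE G) → GraphWithLoops.V H) where
  open GraphWithLoops H
  open LooplessMultigraph G

  Joins : Fin nE → Fin nV → Fin nV → Set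
  Joins e x y = (src e ≡ x × tgt e ≡ y) ⊎ (src e ≡ y × tgt e ≡ x)

  Parallel : Fin nE → Fin nE → Set
  Parallel e g = e ≢ g × Joins g (src e) (tgt e)

  -- The graph L_2^H(G).
  -- Vertex f(x,e) (x an end of e) is encoded as (e , b) with
  -- b = false ↦ x = src e, b = true ↦ x = tgt e (the ends are distinct).
  L2Vertex : Set
  L2Vertex = Fin nE × Bool

  endpt : L2Vertex → Fin nV
  endpt (e , false) = src e
  endpt (e , true)  = tgt e

  -- the pair f(x,e) f(y,e), i.e. the joint matching M_J
  JointEdge : L2Vertex → L2Vertex → Set
  JointEdge p q = proj₁ p ≡ proj₁ q × p ≢ q

  L2Adj : L2Vertex → L2Vertex → Set
  L2Adj p q =
      JointEdge p q
    ⊎ (endpt p ≡ endpt q × proj₁ p ≢ proj₁ q × Adj (c (proj₁ p)) (c (proj₁ q)))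
    ⊎ (endpt p ≢ endpt q × Parallel (proj₁ p) (proj₁ q))

  L2minusMJ : L2Vertex → L2Vertex → Set
  L2minusMJ p q = L2Adj p q × ¬ JointEdge p q

  -- Dynamic H-walks.  A walk (v0, e_0^1..e_0^{k0}, v1, ..., v_n) is given by
  -- the nonempty list of blocks (v_i , e_i^1 ∷ ... ∷ e_i^{k_i}) (i < n)
  -- together with the final vertex v_n.
  record Block : Set where
    constructor block
    field
      start : Fin nV
      edges : List⁺ (Fin nE)
  open Block public

  data IsDWalk : Block → List Block → Fin nV → Set where
    one  : ∀ {b y} →
           All (λ e → Joins e (start b) y) (toList (edges b)) →
           IsDWalk b [] y
    cons : ∀ {b b′ bs y} →
           All (λ e → Joins e (start b) (start b′)) (toList (edges b)) →
           Adj (c (last (edges b))) (c (head (edges b′))) →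
           IsDWalk b′ bs y →
           IsDWalk b (b′ ∷ bs) y

  walkEdges : Block → List Block → List (Fin nE)
  walkEdges b bs = concatMap (λ b → toList (edges b)) (b ∷ bs)

  lastEdge : Block → List Block → Fin nE
  lastEdge b []        = last (edges b)
  lastEdge b (b′ ∷ bs) = lastEdge b′ bs

  -- v_1 (which is the final vertex when n = 1)
  secondVertex : List Block → Fin nV → Fin nV
  secondVertex []       y = y
  secondVertex (b′ ∷ _) y = start b′

  IsClosed : Block → List Block → Fin nV → Set
  IsClosed b bs y =
      (start b ≡ y × Adj (c (lastEdge b bs)) (c (head (edges b))))
    ⊎ (secondVertex bs y ≡ y × Parallel (lastEdge b bs) (head (edges b)))

  record ClosedDTrail : Set where
    field
      first  : Block
      rest   : List Block
      final  : Fin nV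
      walk   : IsDWalk first rest final
      trail  : Unique (walkEdges first rest)
      closed : IsClosed first rest final

  trailEdges : ClosedDTrail → List (Fin nE)
  trailEdges W = walkEdges (ClosedDTrail.first W) (ClosedDTrail.rest W)

  record ClosedDTrailPartition : Set where
    field
      trails    : List ClosedDTrail
      partition : concatMap trailEdges trails ↭ allFin nE

-- The vertex f(x,e) of L₂ᴴ(G) is a dart: the edge e traversed away from its end x.
-- A closed dynamic H-trail is then a cyclic sequence of darts with distinct edges in
-- which every dart d is followed by a dart adjacent, in L₂ᴴ(G) ∖ M_J, to the reverse
-- of d: colour-adjacent edges meet at the vertex where d ends, while consecutive
-- parallel edges of one step of the walk are the parallel-edge adjacencies.
--
-- Given a partition into closed trails, matching the reverse of each dart with its
-- successor is a perfect matching of L₂ᴴ(G) ∖ M_J.  Conversely, a perfect matching σ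
-- and the reversal ι are fixed-point-free involutions of the darts, and the orbits of
-- τ = σ ∘ ι are such cyclic sequences.  An orbit never contains both darts of an edge:
-- as ι τ ι = τ⁻¹, an equation τᵏ x ≡ ι x descends to τᵏ⁻² (τ x) ≡ ι (τ x), and finally
-- to a fixed point of ι or of σ.  Hence the orbits through one dart of each edge
-- partition E(G).

module Submission where

open import Defs
open import Data.Fin using (Fin; toℕ)
open import Function.Bundles using (_⇔_; mk⇔; _↣_; Injection)

open import Data.Bool using (true; false; not)
import Data.Bool.Properties as Boolₚ
open import Data.Empty using (⊥-elim)
open import Data.Fin.Properties as Finₚ using (pigeonhole; *↔×; 2↔Bool)
open import Data.List using (List; []; _∷_; _∷ʳ_; _++_; initLast; _∷ʳ′_; map; concatMap; applyUpTo; allFin)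
import Data.List.Properties as Listₚ
open import Data.List.NonEmpty using (List⁺; _∷_; last; head; toList)
open import Data.List.Membership.Propositional using (_∈_)
open import Data.List.Membership.Propositional.Properties
  using (∈-map⁺; ∈-map⁻; ∈-applyUpTo⁺; ∈-applyUpTo⁻; ∈-++⁺ˡ; ∈-++⁺ʳ)
open import Data.List.Membership.Propositional.Properties
  using (∈-concatMap⁺; ∈-concatMap⁻; ∈-allFin)
open import Data.List.Membership.Propositional.Properties.WithK using (unique∧set⇒bag)
open import Data.List.Relation.Binary.BagAndSetEquality using (∼bag⇒↭)
open import Data.List.Relation.Binary.Permutation.Propositional using (_↭_; ↭-refl; ↭-sym; ↭⇒↭ₛ)
import Data.List.Relation.Binary.Permutation.Propositional.Properties as Permₚ
import Data.List.Relation.Binary.Permutation.Setoid.Properties as PermSetoidₚ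
open import Data.List.Relation.Unary.All as All using (All; []; _∷_)
import Data.List.Relation.Unary.All.Properties as Allₚ
open import Data.List.Relation.Unary.AllPairs using ([]; _∷_)
open import Data.List.Relation.Unary.Any as Any using (here; there)
open import Data.List.Relation.Unary.Linked as Linked using (Linked; [-]; _∷_)
import Data.List.Relation.Unary.Linked.Properties as Linkedₚ
open import Data.List.Relation.Unary.Unique.Propositional using (Unique)
import Data.List.Relation.Unary.Unique.Propositional.Properties as Uniqueₚ
open import Data.Nat using (ℕ; zero; suc; _+_; _*_; _<_; _≤_; s≤s)
import Data.Nat.Properties as ℕ
open import Data.Nat.Induction using (<-rec)
open import Data.Product using (∃; _×_; _,_; proj₁; proj₂; uncurry; map₁)
open import Data.Product.Function.NonDependent.Propositional using (_×-↔_)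
open import Data.Sum as Sum using (_⊎_; inj₁; inj₂; [_,_])
open import Function.Base using (_∘_)
import Function.Properties.Equivalence as ⇔
open import Function.Properties.Inverse using (↔-refl; ↔-sym; ↔-trans; ↔⇒↣)
open import Relation.Binary.Definitions using (DecidableEquality)
open import Relation.Binary.PropositionalEquality
  using (_≡_; _≢_; refl; sym; trans; cong; subst; subst₂; setoid; module ≡-Reasoning)
open import Relation.Nullary using (¬_; yes; no)
open import Relation.Unary using (Decidable)

private
  variable
    A B C : Set

lastOf : A → List A → A
lastOf x []       = x
lastOf x (y ∷ ys) = lastOf y ys

lastOf-∈ : (x : A) (xs : List A) → lastOf x xs ∈ x ∷ xs
lastOf-∈ x []       = here refl
lastOf-∈ x (y ∷ xs) = there (lastOf-∈ y xs)

lastOf-∷ʳ : (x : A) (ys : List A) (y : A) → lastOf x (ys ∷ʳ y) ≡ y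
lastOf-∷ʳ x []       y = refl
lastOf-∷ʳ x (z ∷ ys) y = lastOf-∷ʳ z ys y

last≡lastOf : (x : A) (xs : List A) → last (x ∷ xs) ≡ lastOf x xs
last≡lastOf x xs with initLast xs
... | []        = refl
... | ys ∷ʳ′ y  = sym (lastOf-∷ʳ x ys y)

last-∷-toList : (x : A) (ys : List⁺ A) → last (x ∷ toList ys) ≡ last ys
last-∷-toList x (y ∷ ys) = trans (last≡lastOf x (y ∷ ys)) (sym (last≡lastOf y ys))

lastOf-map : (f : A → B) (x : A) (xs : List A) → f (lastOf x xs) ≡ lastOf (f x) (map f xs)
lastOf-map f x []       = refl
lastOf-map f x (y ∷ xs) = lastOf-map f y xs

last-∷-map : (f : A → B) (x : A) (xs : List A) → last (f x ∷ map f xs) ≡ f (lastOf x xs)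
last-∷-map f x xs = trans (last≡lastOf (f x) (map f xs)) (sym (lastOf-map f x xs))

lastOf-++ : (x : A) (xs : List A) (y : A) (ys : List A) → lastOf x (xs ++ y ∷ ys) ≡ lastOf y ys
lastOf-++ x []       y ys = refl
lastOf-++ x (z ∷ xs) y ys = lastOf-++ z xs y ys

Linked-++ : {R : A → A → Set} {x y : A} {xs ys : List A} →
            Linked R (x ∷ xs) → R (lastOf x xs) y → Linked R (y ∷ ys) → Linked R (x ∷ xs ++ y ∷ ys)
Linked-++ [-]         Rxy Rys = Rxy ∷ Rys
Linked-++ (Rxz ∷ Rzs) Rxy Rys = Rxz ∷ Linked-++ Rzs Rxy Rys

lastOf-applyUpTo : (f : ℕ → A) (n : ℕ) → lastOf (f 0) (applyUpTo (λ i → f (suc i)) n) ≡ f n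
lastOf-applyUpTo f zero    = refl
lastOf-applyUpTo f (suc n) = lastOf-applyUpTo (λ i → f (suc i)) n

data Cyclic (R : A → A → Set) : List A → Set where
  cyclic : ∀ {x xs} → Linked R (x ∷ xs) → R (lastOf x xs) x → Cyclic R (x ∷ xs)

Cyclic-map : {R S : A → A → Set} → (∀ {a b} → R a b → S a b) →
             ∀ {xs} → Cyclic R xs → Cyclic S xs
Cyclic-map f (cyclic Rxs Rlast) = cyclic (Linked.map f Rxs) (f Rlast)

pairsClosingAt : A → A → List A → List (A × A)
pairsClosingAt x₀ y []       = (y , x₀) ∷ []
pairsClosingAt x₀ y (z ∷ zs) = (y , z) ∷ pairsClosingAt x₀ z zs

cyclicPairs : List A → List (A × A)
cyclicPairs []       = []
cyclicPairs (x ∷ xs) = pairsClosingAt x x xs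

map-proj₁-cyclicPairs : (xs : List A) → map proj₁ (cyclicPairs xs) ≡ xs
map-proj₁-cyclicPairs []       = refl
map-proj₁-cyclicPairs (x ∷ xs) = go x xs
  where
  go : ∀ y zs → map proj₁ (pairsClosingAt x y zs) ≡ y ∷ zs
  go y []       = refl
  go y (z ∷ zs) = cong (y ∷_) (go z zs)

map-proj₂-cyclicPairs : (xs : List A) → map proj₂ (cyclicPairs xs) ↭ xs
map-proj₂-cyclicPairs []       = ↭-refl
map-proj₂-cyclicPairs (x ∷ xs) = subst (_↭ x ∷ xs) (sym (go x xs)) (↭-sym (Permₚ.∷↭∷ʳ x xs))
  where
  go : ∀ y zs → map proj₂ (pairsClosingAt x y zs) ≡ zs ∷ʳ x
  go y []       = refl
  go y (z ∷ zs) = cong (z ∷_) (go z zs)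

Cyclic⇒All-cyclicPairs : {R : A → A → Set} {xs : List A} → Cyclic R xs → All (uncurry R) (cyclicPairs xs)
Cyclic⇒All-cyclicPairs {R = R} (cyclic {x} Rxs Rlast) = go Rxs Rlast
  where
  go : ∀ {y zs} → Linked R (y ∷ zs) → R (lastOf y zs) x → All (uncurry R) (pairsClosingAt x y zs)
  go [-]         Rlast = Rlast ∷ []
  go (Ryz ∷ Rzs) Rlast = Ryz ∷ go Rzs Rlast

Unique-resp-↭ : {xs ys : List A} → xs ↭ ys → Unique xs → Unique ys
Unique-resp-↭ p = PermSetoidₚ.Unique-resp-↭ (setoid _) (↭⇒↭ₛ p)

Unique-map⇒injective : (f : A → B) {xs : List A} → Unique (map f xs) →
                       ∀ {x y} → x ∈ xs → y ∈ xs → f x ≡ f y → x ≡ y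
Unique-map⇒injective f _          (here refl) (here refl) _     = refl
Unique-map⇒injective f (fx∉ ∷ _)  (here refl) (there y∈)  fx≡fy =
  ⊥-elim (All.lookup fx∉ (∈-map⁺ f y∈) fx≡fy)
Unique-map⇒injective f (fy∉ ∷ _)  (there x∈)  (here refl) fx≡fy =
  ⊥-elim (All.lookup fy∉ (∈-map⁺ f x∈) (sym fx≡fy))
Unique-map⇒injective f (_ ∷ uniq) (there x∈)  (there y∈)  fx≡fy =
  Unique-map⇒injective f uniq x∈ y∈ fx≡fy

Unique∧complete⇒↭allFin : ∀ {n} {xs : List (Fin n)} → Unique xs → (∀ {i} → i ∈ xs) → xs ↭ allFin n
Unique∧complete⇒↭allFin {n} unique complete =
  ∼bag⇒↭ (unique∧set⇒bag unique (Uniqueₚ.allFin⁺ n) (mk⇔ (λ _ → ∈-allFin _) (λ _ → complete)))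

concatMap-map-≗ : {f : B → List C} {g : A → List C} (h : A → B) →
                  (∀ a → f (h a) ≡ g a) → ∀ xs → concatMap f (map h xs) ≡ concatMap g xs
concatMap-map-≗ {f = f} h fh≗g xs = trans (Listₚ.concatMap-map f h xs) (Listₚ.concatMap-cong fh≗g xs)

concatMap-↭ : {f g : A → List B} → (∀ a → f a ↭ g a) →
              ∀ xs → concatMap f xs ↭ concatMap g xs
concatMap-↭ f↭g []       = ↭-refl
concatMap-↭ f↭g (x ∷ xs) = Permₚ.++⁺ (f↭g x) (concatMap-↭ f↭g xs)

-- Iterates and orbits

module _ {P : ℕ → Set} (P? : Decidable P) where

  minimal-witness : ∀ n → P n → ∃ λ k → P k × (∀ {j} → j < k → ¬ P j)
  minimal-witness = <-rec (λ n → P n → Minimal) descend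
    where
    Minimal = ∃ λ k → P k × (∀ {j} → j < k → ¬ P j)
    descend : ∀ n → (∀ {m} → m < n → P m → Minimal) → P n → Minimal
    descend n below Pn with ℕ.anyUpTo? P? n
    ... | yes (m , m<n , Pm) = below m<n Pm
    ... | no none            = n , Pn , λ {j} j<n Pj → none (j , j<n , Pj)

infixr 8 _^_

_^_ : (A → A) → ℕ → A → A
(f ^ zero)  x = x
(f ^ suc k) x = f ((f ^ k) x)

module _ (f : A → A) where

  ^-+ : ∀ m k x → (f ^ (m + k)) x ≡ (f ^ m) ((f ^ k) x)
  ^-+ zero    k x = refl
  ^-+ (suc m) k x = cong f (^-+ m k x)

  ^-suc : ∀ k x → (f ^ suc k) x ≡ (f ^ k) (f x)
  ^-suc k x = trans (cong (λ m → (f ^ m) x) (ℕ.+-comm 1 k)) (^-+ k 1 x)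

  ^-injective : (∀ {x y} → f x ≡ f y → x ≡ y) → ∀ k {x y} → (f ^ k) x ≡ (f ^ k) y → x ≡ y
  ^-injective f-inj zero    eq = eq
  ^-injective f-inj (suc k) eq = ^-injective f-inj k (f-inj eq)

module Orbits {A : Set} {n : ℕ} (A↣Fin : A ↣ Fin n) (τ : A → A)
              (τ-injective : ∀ {x y} → τ x ≡ τ y → x ≡ y) where

  open Injection A↣Fin using (to; injective)

  recurrent : ∀ x → ∃ λ t → (τ ^ suc t) x ≡ x
  recurrent x with pigeonhole (ℕ.n<1+n n) (λ i → to ((τ ^ toℕ i) x))
  ... | i , j , i<j , eq with ℕ.m≤n⇒∃[o]m+o≡n i<j
  ... | t , i+1+t≡j = t , ^-injective τ τ-injective (toℕ i) (begin
      (τ ^ toℕ i) ((τ ^ suc t) x)   ≡⟨ ^-+ τ (toℕ i) (suc t) x ⟨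
      (τ ^ (toℕ i + suc t)) x       ≡⟨ cong (λ m → (τ ^ m) x) (trans (ℕ.+-suc (toℕ i) t) i+1+t≡j) ⟩
      (τ ^ toℕ j) x                 ≡⟨ injective eq ⟨
      (τ ^ toℕ i) x                 ∎)
    where open ≡-Reasoning

  private
    _≟_ : DecidableEquality A
    _≟_ = Finₚ.inj⇒≟ A↣Fin

    -- opaque, so that the type checker never unfolds the pigeonhole search
    opaque
      firstReturn : ∀ x → ∃ λ t → (τ ^ suc t) x ≡ x × (∀ {j} → j < t → (τ ^ suc j) x ≢ x)
      firstReturn x = minimal-witness (λ t → (τ ^ suc t) x ≟ x) (proj₁ (recurrent x)) (proj₂ (recurrent x))

  period : A → ℕ
  period x = suc (proj₁ (firstReturn x))

  τ^period : ∀ x → (τ ^ period x) x ≡ x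
  τ^period x = proj₁ (proj₂ (firstReturn x))

  period-minimal : ∀ x {j} → suc j < period x → (τ ^ suc j) x ≢ x
  period-minimal x (s≤s j<t) = proj₂ (proj₂ (firstReturn x)) j<t

  orbit : A → List A
  orbit x = applyUpTo (λ i → (τ ^ i) x) (period x)

  orbit-injective : ∀ x {i j} → i < j → j < period x → (τ ^ i) x ≢ (τ ^ j) x
  orbit-injective x {i} {j} i<j j<p τⁱx≡τʲx with ℕ.m≤n⇒∃[o]m+o≡n i<j
  ... | t , refl = period-minimal x (ℕ.≤-<-trans (s≤s (ℕ.m≤n+m t i)) j<p)
    (^-injective τ τ-injective i (sym (begin
      (τ ^ i) x                 ≡⟨ τⁱx≡τʲx ⟩
      (τ ^ suc (i + t)) x       ≡⟨ cong (λ m → (τ ^ m) x) (ℕ.+-suc i t) ⟨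
      (τ ^ (i + suc t)) x       ≡⟨ ^-+ τ i (suc t) x ⟩
      (τ ^ i) ((τ ^ suc t) x)   ∎)))
    where open ≡-Reasoning

  orbit-closed : ∀ {x y} → y ∈ orbit x → τ y ∈ orbit x
  orbit-closed {x} y∈ with ∈-applyUpTo⁻ (λ i → (τ ^ i) x) y∈
  ... | i , i<p , refl with ℕ.m≤n⇒m<n∨m≡n i<p
  ... | inj₁ 1+i<p = ∈-applyUpTo⁺ (λ i → (τ ^ i) x) 1+i<p
  ... | inj₂ 1+i≡p =
    subst (_∈ orbit x) (sym (trans (cong (λ m → (τ ^ m) x) 1+i≡p) (τ^period x))) (here refl)

  orbit-closed^ : ∀ k {x y} → y ∈ orbit x → (τ ^ k) y ∈ orbit x
  orbit-closed^ zero    y∈ = y∈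
  orbit-closed^ (suc k) y∈ = orbit-closed (orbit-closed^ k y∈)

  orbit-⊆ : ∀ {x x′ y} → y ∈ orbit x → y ∈ orbit x′ → x ∈ orbit x′
  orbit-⊆ {x} y∈ y∈′ with ∈-applyUpTo⁻ (λ i → (τ ^ i) x) y∈
  ... | β , β<p , refl with ℕ.m≤n⇒∃[o]m+o≡n (ℕ.<⇒≤ β<p)
  ... | r , β+r≡p = subst (_∈ _) (begin
      (τ ^ r) ((τ ^ β) x)     ≡⟨ ^-+ τ r β x ⟨
      (τ ^ (r + β)) x         ≡⟨ cong (λ m → (τ ^ m) x) (trans (ℕ.+-comm r β) β+r≡p) ⟩
      (τ ^ period x) x        ≡⟨ τ^period x ⟩
      x                       ∎) (orbit-closed^ r y∈′)
    where open ≡-Reasoning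

  orbit-cyclic : ∀ x → Cyclic (λ a b → τ a ≡ b) (orbit x)
  orbit-cyclic x = cyclic (Linkedₚ.applyUpTo⁺₂ (λ i → (τ ^ i) x) (period x) (λ i → refl))
    (trans (cong τ (lastOf-applyUpTo (λ i → (τ ^ i) x) (proj₁ (firstReturn x)))) (τ^period x))

module TwoInvolutions {A : Set} {n : ℕ} (A↣Fin : A ↣ Fin n) (ι σ : A → A)
                      (ι-involutive : ∀ x → ι (ι x) ≡ x) (σ-involutive : ∀ x → σ (σ x) ≡ x)
                      (ι-fixedPointFree : ∀ x → ι x ≢ x) (σ-fixedPointFree : ∀ x → σ x ≢ x) where

  τ : A → A
  τ x = σ (ι x)

  τ-injective : ∀ {x y} → τ x ≡ τ y → x ≡ y
  τ-injective {x} {y} eq = begin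
    x             ≡⟨ ι-involutive x ⟨
    ι (ι x)       ≡⟨ cong ι (σ-involutive (ι x)) ⟨
    ι (σ (τ x))   ≡⟨ cong (λ z → ι (σ z)) eq ⟩
    ι (σ (τ y))   ≡⟨ cong ι (σ-involutive (ι y)) ⟩
    ι (ι y)       ≡⟨ ι-involutive y ⟩
    y             ∎
    where open ≡-Reasoning

  open Orbits A↣Fin τ τ-injective public

  τ^∘ι∘τ^ : ∀ k x → (τ ^ k) (ι ((τ ^ k) x)) ≡ ι x
  τ^∘ι∘τ^ zero    x = refl
  τ^∘ι∘τ^ (suc k) x = begin
    (τ ^ suc k) (ι (τ ((τ ^ k) x)))          ≡⟨ ^-suc τ k _ ⟩
    (τ ^ k) (σ (ι (ι (σ (ι ((τ ^ k) x))))))  ≡⟨ cong (λ z → (τ ^ k) (σ z)) (ι-involutive _) ⟩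
    (τ ^ k) (σ (σ (ι ((τ ^ k) x))))          ≡⟨ cong (τ ^ k) (σ-involutive _) ⟩
    (τ ^ k) (ι ((τ ^ k) x))                  ≡⟨ τ^∘ι∘τ^ k x ⟩
    ι x                                      ∎
    where open ≡-Reasoning

  τ^≢ι : ∀ k x → (τ ^ k) x ≢ ι x
  τ^≢ι zero          x eq = ι-fixedPointFree x (sym eq)
  τ^≢ι (suc zero)    x eq = σ-fixedPointFree (ι x) eq
  τ^≢ι (suc (suc k)) x eq = τ^≢ι k (τ x) (begin
    (τ ^ k) (τ x)                        ≡⟨ ^-suc τ k x ⟨
    w                                    ≡⟨ ι-involutive w ⟨
    ι (ι w)                              ≡⟨ cong ι (σ-involutive (ι w)) ⟨
    ι (σ (τ w))                          ≡⟨ cong (λ z → ι (σ z)) eq ⟩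
    ι (τ x)                              ∎)
    where
    open ≡-Reasoning
    w = (τ ^ suc k) x

  private
    τ^≢ι∘τ^-ordered : ∀ {i j} x → i ≤ j → (τ ^ j) x ≢ ι ((τ ^ i) x)
    τ^≢ι∘τ^-ordered {i} x i≤j eq with ℕ.m≤n⇒∃[o]m+o≡n i≤j
    ... | o , refl = τ^≢ι o ((τ ^ i) x)
      (trans (sym (trans (cong (λ m → (τ ^ m) x) (ℕ.+-comm i o)) (^-+ τ o i x))) eq)

  τ^≢ι∘τ^ : ∀ i j x → (τ ^ j) x ≢ ι ((τ ^ i) x)
  τ^≢ι∘τ^ i j x with ℕ.≤-total i j
  ... | inj₁ i≤j = τ^≢ι∘τ^-ordered x i≤j
  ... | inj₂ j≤i = λ eq → τ^≢ι∘τ^-ordered x j≤i (trans (sym (ι-involutive _)) (cong ι (sym eq)))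

  orbit-meets-ι : ∀ {x x′ y} → y ∈ orbit x → ι y ∈ orbit x′ → ι x ∈ orbit x′
  orbit-meets-ι {x} y∈ ιy∈′ with ∈-applyUpTo⁻ (λ i → (τ ^ i) x) y∈
  ... | β , _ , refl = subst (_∈ _) (τ^∘ι∘τ^ β x) (orbit-closed^ β ιy∈′)

module Representatives {B : Set} (_≟_ : DecidableEquality B) (class : B → List B)
                       (class-unique : ∀ b → Unique (class b)) (∈-class : ∀ b → b ∈ class b)
                       (class-overlap : ∀ {b b′ y} → y ∈ class b → y ∈ class b′ → b ∈ class b′) where

  representatives : (bs : List B) →
                    ∃ λ S → Unique (concatMap class S) × (∀ {b} → b ∈ bs → b ∈ concatMap class S)
  representatives [] = [] , [] , λ ()
  representatives (b ∷ bs) with representatives bs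
  ... | S , unique , covers with Any.any? (b ≟_) (concatMap class S)
  ... | yes b∈ = S , unique , λ { (here refl) → b∈ ; (there b∈bs) → covers b∈bs }
  ... | no  b∉ = b ∷ S , Uniqueₚ.++⁺ (class-unique b) unique disjoint ,
                 λ { (here refl)  → ∈-++⁺ˡ (∈-class b)
                   ; (there b∈bs) → ∈-++⁺ʳ (class b) (covers b∈bs) }
    where
    disjoint : ∀ {y} → ¬ (y ∈ class b × y ∈ concatMap class S)
    disjoint (y∈ , y∈S) = b∉ (∈-concatMap⁺ class {xs = S}
      (Any.map (λ y∈′ → class-overlap y∈ y∈′) (∈-concatMap⁻ class {xs = S} y∈S)))

module PairsMatching {A : Set} {R : A → A → Set} (R-sym : ∀ {p q} → R p q → R q p)
                     (L : List (A × A)) (R-pairs : All (uncurry R) L)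
                     (unique₁ : Unique (map proj₁ L)) (unique₂ : Unique (map proj₂ L))
                     (disjoint : ∀ {p} → p ∈ map proj₁ L → ¬ p ∈ map proj₂ L)
                     (complete : ∀ p → p ∈ map proj₁ L ⊎ p ∈ map proj₂ L) where

  Matched : A → A → Set
  Matched p q = (p , q) ∈ L ⊎ (q , p) ∈ L

  Matched-sym : ∀ {p q} → Matched p q → Matched q p
  Matched-sym (inj₁ pq∈) = inj₂ pq∈
  Matched-sym (inj₂ qp∈) = inj₁ qp∈

  Matched⇒R : ∀ {p q} → Matched p q → R p q
  Matched⇒R (inj₁ pq∈) = All.lookup R-pairs pq∈
  Matched⇒R (inj₂ qp∈) = R-sym (All.lookup R-pairs qp∈)

  Matched-functional : ∀ {p q q′} → Matched p q′ → Matched p q → q′ ≡ q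
  Matched-functional (inj₁ pq′∈) (inj₁ pq∈) =
    cong proj₂ (Unique-map⇒injective proj₁ unique₁ pq′∈ pq∈ refl)
  Matched-functional (inj₂ q′p∈) (inj₂ qp∈) =
    cong proj₁ (Unique-map⇒injective proj₂ unique₂ q′p∈ qp∈ refl)
  Matched-functional (inj₁ pq′∈) (inj₂ qp∈) = ⊥-elim (disjoint (∈-map⁺ proj₁ pq′∈) (∈-map⁺ proj₂ qp∈))
  Matched-functional (inj₂ q′p∈) (inj₁ pq∈) = ⊥-elim (disjoint (∈-map⁺ proj₁ pq∈) (∈-map⁺ proj₂ q′p∈))

  partner : ∀ p → ∃ λ q → Matched p q
  partner p with complete p
  ... | inj₁ p∈ with ∈-map⁻ proj₁ p∈
  ...   | (_ , q) , pq∈ , refl = q , inj₁ pq∈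
  partner p | inj₂ p∈ with ∈-map⁻ proj₂ p∈
  ...   | (q , _) , qp∈ , refl = q , inj₂ qp∈

  perfectMatching : PerfectMatching R
  perfectMatching = record
    { M = Matched ; M-sym = Matched-sym ; M⊆A = Matched⇒R
    ; cover = λ p → proj₁ (partner p) , proj₂ (partner p) , λ _ m → Matched-functional m (proj₂ (partner p))
    }

-- Darts

module _ (H : GraphWithLoops) (G : LooplessMultigraph)
         (c : Fin (LooplessMultigraph.nE G) → GraphWithLoops.V H) where
  open GraphWithLoops H renaming (sym to Adj-sym)
  open LooplessMultigraph G

  Dart : Set
  Dart = L2Vertex H G c

  edgeOf : Dart → Fin nE
  edgeOf = proj₁

  opposite : Dart → Dart
  opposite d = edgeOf d , not (proj₂ d)

  origin target : Dart → Fin nV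
  origin   = endpt H G c
  target d = origin (opposite d)

  opposite-involutive : ∀ d → opposite (opposite d) ≡ d
  opposite-involutive (e , b) = cong (e ,_) (Boolₚ.not-involutive b)

  opposite-injective : ∀ {p q} → opposite p ≡ opposite q → p ≡ q
  opposite-injective {p} {q} eq =
    trans (sym (opposite-involutive p)) (trans (cong opposite eq) (opposite-involutive q))

  opposite-fixedPointFree : ∀ d → opposite d ≢ d
  opposite-fixedPointFree (e , false) ()
  opposite-fixedPointFree (e , true)  ()

  same-edge : ∀ {p q} → edgeOf p ≡ edgeOf q → p ≡ q ⊎ p ≡ opposite q
  same-edge {e , false} {.e , false} refl = inj₁ refl
  same-edge {e , false} {.e , true}  refl = inj₂ refl
  same-edge {e , true}  {.e , false} refl = inj₂ refl
  same-edge {e , true}  {.e , true}  refl = inj₁ refl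

  dart↣Fin : Dart ↣ Fin (nE * 2)
  dart↣Fin = ↔⇒↣ (↔-trans (↔-refl ×-↔ ↔-sym 2↔Bool) (↔-sym *↔×))

  Joins-dart : ∀ d → Joins H G c (edgeOf d) (origin d) (target d)
  Joins-dart (e , false) = inj₁ (refl , refl)
  Joins-dart (e , true)  = inj₂ (refl , refl)

  dart-of-Joins : ∀ {e s t} → Joins H G c e s t → ∃ λ d → edgeOf d ≡ e × origin d ≡ s × target d ≡ t
  dart-of-Joins {e} (inj₁ (s≡ , t≡)) = (e , false) , refl , s≡ , t≡
  dart-of-Joins {e} (inj₂ (t≡ , s≡)) = (e , true)  , refl , s≡ , t≡

  Joins-distinct : ∀ {e s t} → Joins H G c e s t → s ≢ t
  Joins-distinct {e} (inj₁ (refl , refl)) = loopless e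
  Joins-distinct {e} (inj₂ (refl , refl)) = loopless e ∘ sym

  origin≢target : ∀ d → origin d ≢ target d
  origin≢target d = Joins-distinct (Joins-dart d)

  Joins-flip : ∀ {e s t} → Joins H G c e s t → Joins H G c e t s
  Joins-flip (inj₁ ends) = inj₂ ends
  Joins-flip (inj₂ ends) = inj₁ ends

  Joins-orient : ∀ {e} a → Joins H G c e (origin a) (target a) → Joins H G c e (src (edgeOf a)) (tgt (edgeOf a))
  Joins-orient (_ , false) J = J
  Joins-orient (_ , true)  J = Joins-flip J

  Joins-swap : ∀ {e g} → Joins H G c g (src e) (tgt e) → Joins H G c e (src g) (tgt g)
  Joins-swap (inj₁ (s≡ , t≡)) = inj₁ (sym s≡ , sym t≡)
  Joins-swap (inj₂ (s≡ , t≡)) = inj₂ (sym t≡ , sym s≡)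

  L2Adj-sym : ∀ {p q} → L2Adj H G c p q → L2Adj H G c q p
  L2Adj-sym (inj₁ (e≡ , p≢q))                  = inj₁ (sym e≡ , p≢q ∘ sym)
  L2Adj-sym (inj₂ (inj₁ (x≡ , e≢ , adj)))      = inj₂ (inj₁ (sym x≡ , e≢ ∘ sym , Adj-sym adj))
  L2Adj-sym (inj₂ (inj₂ (x≢ , e≢ , joins)))    = inj₂ (inj₂ (x≢ ∘ sym , e≢ ∘ sym , Joins-swap joins))

  L2Adj-irreflexive : ∀ {p} → ¬ L2Adj H G c p p
  L2Adj-irreflexive (inj₁ (_ , p≢p))            = p≢p refl
  L2Adj-irreflexive (inj₂ (inj₁ (_ , e≢e , _))) = e≢e refl
  L2Adj-irreflexive (inj₂ (inj₂ (_ , e≢e , _))) = e≢e refl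

  L2minusMJ-sym : ∀ {p q} → L2minusMJ H G c p q → L2minusMJ H G c q p
  L2minusMJ-sym (adj , ¬joint) = L2Adj-sym adj , λ (e≡ , q≢p) → ¬joint (sym e≡ , q≢p ∘ sym)

  Follows : Dart → Dart → Set
  Follows a b = L2minusMJ H G c (opposite a) b

  -- Follows without the requirement that the two edges differ: the condition a dynamic walk imposes
  -- on consecutive edges.
  Transition : Dart → Dart → Set
  Transition a b = (target a ≡ origin b × Adj (c (edgeOf a)) (c (edgeOf b)))
                 ⊎ (target a ≢ origin b × Joins H G c (edgeOf b) (src (edgeOf a)) (tgt (edgeOf a)))

  Follows⇒Transition : ∀ {a b} → Follows a b → edgeOf a ≢ edgeOf b × Transition a b
  Follows⇒Transition (inj₁ joint , ¬joint)                   = ⊥-elim (¬joint joint)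
  Follows⇒Transition (inj₂ (inj₁ (x≡ , e≢ , adj)) , _)       = e≢ , inj₁ (x≡ , adj)
  Follows⇒Transition (inj₂ (inj₂ (x≢ , (e≢ , joins))) , _)   = e≢ , inj₂ (x≢ , joins)

  Transition⇒Follows : ∀ {a b} → edgeOf a ≢ edgeOf b → Transition a b → Follows a b
  Transition⇒Follows e≢ (inj₁ (x≡ , adj))   = inj₂ (inj₁ (x≡ , e≢ , adj)) , e≢ ∘ proj₁
  Transition⇒Follows e≢ (inj₂ (x≢ , joins)) = inj₂ (inj₂ (x≢ , e≢ , joins)) , e≢ ∘ proj₁

  parallel-ends : ∀ a b → target a ≢ origin b → Joins H G c (edgeOf b) (src (edgeOf a)) (tgt (edgeOf a)) →
                  origin b ≡ origin a × target b ≡ target a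
  parallel-ends (_ , false) (_ , false) _  (inj₁ (p , q)) = p , q
  parallel-ends (_ , false) (_ , false) x≢ (inj₂ (p , _)) = ⊥-elim (x≢ (sym p))
  parallel-ends (_ , false) (_ , true)  x≢ (inj₁ (_ , q)) = ⊥-elim (x≢ (sym q))
  parallel-ends (_ , false) (_ , true)  _  (inj₂ (p , q)) = q , p
  parallel-ends (_ , true)  (_ , false) x≢ (inj₁ (p , _)) = ⊥-elim (x≢ (sym p))
  parallel-ends (_ , true)  (_ , false) _  (inj₂ (p , q)) = p , q
  parallel-ends (_ , true)  (_ , true)  _  (inj₁ (p , q)) = q , p
  parallel-ends (_ , true)  (_ , true)  x≢ (inj₂ (_ , q)) = ⊥-elim (x≢ (sym q))

  -- Closed dynamic trails as dart cycles

  record DartCycle : Set where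
    field
      darts        : List Dart
      follows      : Cyclic Follows darts
      edges-unique : Unique (map edgeOf darts)

  cycleEdges : DartCycle → List (Fin nE)
  cycleEdges C = map edgeOf (DartCycle.darts C)

  record Traces (b : Block H G c) (bs : List (Block H G c)) (y : Fin nV) (d : Dart) (ds : List Dart) : Set where
    field
      edges≡     : walkEdges H G c b bs ≡ map edgeOf (d ∷ ds)
      start≡     : start b ≡ origin d
      firstEdge≡ : head (edges b) ≡ edgeOf d
      final≡     : y ≡ target (lastOf d ds)
      lastEdge≡  : lastEdge H G c b bs ≡ edgeOf (lastOf d ds)
      second≡    : secondVertex H G c bs y ≡ target d

  record TracingWalk (d : Dart) (ds : List Dart) : Set where
    field
      first  : Block H G c
      rest   : List (Block H G c)
      final  : Fin nV
      walk   : IsDWalk H G c first rest final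
      traces : Traces first rest final d ds

  IsDWalk-extend : ∀ {b bs y s e} → start b ≡ s → Joins H G c e s (secondVertex H G c bs y) →
                   IsDWalk H G c b bs y → IsDWalk H G c (block s (e ∷ toList (edges b))) bs y
  IsDWalk-extend refl J (one joins) = one (J ∷ joins)
  IsDWalk-extend {b} refl J (cons joins adj w) =
    cons (J ∷ joins) (subst (λ g → Adj (c g) _) (sym (last-∷-toList _ (edges b))) adj) w

  lastEdge-extend : ∀ b bs s e → lastEdge H G c (block s (e ∷ toList (edges b))) bs ≡ lastEdge H G c b bs
  lastEdge-extend b []      s e = last-∷-toList e (edges b)
  lastEdge-extend b (_ ∷ _) s e = refl

  tracingWalk-single : ∀ d → TracingWalk d []
  tracingWalk-single d = record
    { first = block (origin d) (edgeOf d ∷ []) ; rest = [] ; final = target d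
    ; walk = one (Joins-dart d ∷ [])
    ; traces = record { edges≡ = refl ; start≡ = refl ; firstEdge≡ = refl
                      ; final≡ = refl ; lastEdge≡ = refl ; second≡ = refl } }

  tracingWalk-newBlock : ∀ {d d′ ds} → target d ≡ origin d′ → Adj (c (edgeOf d)) (c (edgeOf d′)) →
                         TracingWalk d′ ds → TracingWalk d (d′ ∷ ds)
  tracingWalk-newBlock {d} x≡ adj W = record
    { first = block (origin d) (edgeOf d ∷ []) ; rest = first ∷ rest ; final = final
    ; walk = cons (subst (Joins H G c (edgeOf d) (origin d)) (trans x≡ (sym start≡)) (Joins-dart d) ∷ [])
                  (subst (λ g → Adj (c (edgeOf d)) (c g)) (sym firstEdge≡) adj) walk
    ; traces = record { edges≡ = cong (edgeOf d ∷_) edges≡ ; start≡ = refl ; firstEdge≡ = refl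
                      ; final≡ = final≡ ; lastEdge≡ = lastEdge≡ ; second≡ = trans start≡ (sym x≡) } }
    where
    open TracingWalk W
    open Traces traces

  tracingWalk-extendBlock : ∀ {d d′ ds} → origin d′ ≡ origin d → target d′ ≡ target d →
                            TracingWalk d′ ds → TracingWalk d (d′ ∷ ds)
  tracingWalk-extendBlock {d} o≡ t≡ W = record
    { first = block (origin d) (edgeOf d ∷ toList (edges first)) ; rest = rest ; final = final
    ; walk = IsDWalk-extend (trans start≡ o≡)
               (subst (Joins H G c (edgeOf d) (origin d)) (sym (trans second≡ t≡)) (Joins-dart d)) walk
    ; traces = record { edges≡ = cong (edgeOf d ∷_) edges≡ ; start≡ = refl ; firstEdge≡ = refl
                      ; final≡ = final≡ ; lastEdge≡ = trans (lastEdge-extend first rest _ _) lastEdge≡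
                      ; second≡ = trans second≡ t≡ } }
    where
    open TracingWalk W
    open Traces traces

  tracingWalk : ∀ {d ds} → Linked Follows (d ∷ ds) → TracingWalk d ds
  tracingWalk {d} [-] = tracingWalk-single d
  tracingWalk {d} {d′ ∷ _} (follows ∷ path) with proj₂ (Follows⇒Transition follows)
  ... | inj₁ (x≡ , adj)   = tracingWalk-newBlock x≡ adj (tracingWalk path)
  ... | inj₂ (x≢ , joins) = uncurry tracingWalk-extendBlock (parallel-ends d d′ x≢ joins) (tracingWalk path)

  IsClosed-of-Follows : ∀ {b bs y d ds} → Traces b bs y d ds → Follows (lastOf d ds) d → IsClosed H G c b bs y
  IsClosed-of-Follows {d = d} {ds} tr follows with Follows⇒Transition follows
  ... | _ , inj₁ (x≡ , adj) =
    inj₁ (trans start≡ (trans (sym x≡) (sym final≡)) ,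
          subst₂ (λ g g′ → Adj (c g) (c g′)) (sym lastEdge≡) (sym firstEdge≡) adj)
    where open Traces tr
  ... | e≢ , inj₂ (x≢ , joins) =
    inj₂ (trans second≡ (trans (proj₂ (parallel-ends (lastOf d ds) d x≢ joins)) (sym final≡)) ,
          subst₂ (Parallel H G c) (sym lastEdge≡) (sym firstEdge≡) (e≢ , joins))
    where open Traces tr

  closedTrail-of-dartCycle : (C : DartCycle) → ∃ λ T → trailEdges H G c T ≡ cycleEdges C
  closedTrail-of-dartCycle C = go (DartCycle.follows C) (DartCycle.edges-unique C)
    where
    go : ∀ {ds} → Cyclic Follows ds → Unique (map edgeOf ds) → ∃ λ T → trailEdges H G c T ≡ map edgeOf ds
    go (cyclic path closing) unique =
      record { first = first ; rest = rest ; final = final ; walk = walk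
             ; trail = subst Unique (sym edges≡) unique ; closed = IsClosed-of-Follows traces closing } , edges≡
      where
      open TracingWalk (tracingWalk path)
      open Traces traces

  Runs : Fin nV → Fin nV → Dart → Set
  Runs s t d = origin d ≡ s × target d ≡ t

  darts-of-block : ∀ {s t} es → All (λ g → Joins H G c g s t) es →
                   ∃ λ ds → map edgeOf ds ≡ es × All (Runs s t) ds
  darts-of-block []       []       = [] , refl , []
  darts-of-block (e ∷ es) (J ∷ Js) with dart-of-Joins J | darts-of-block es Js
  ... | d , refl , runs | ds , refl , runss = d ∷ ds , refl , runs ∷ runss

  parallel-transition : ∀ a b → origin b ≡ origin a → target b ≡ target a → Transition a b
  parallel-transition a b o≡ t≡ =
    inj₂ ((λ x≡ → origin≢target a (sym (trans x≡ o≡))) ,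
          Joins-orient a (subst₂ (Joins H G c (edgeOf b)) o≡ t≡ (Joins-dart b)))

  parallel-linked : ∀ {s t d ds} → All (Runs s t) (d ∷ ds) → Linked Transition (d ∷ ds)
  parallel-linked (_ ∷ []) = [-]
  parallel-linked {d = a} {b ∷ _} ((oa , ta) ∷ runs@((ob , tb) ∷ _)) =
    parallel-transition a b (trans ob (sym oa)) (trans tb (sym ta)) ∷ parallel-linked runs

  record TracingDarts (b : Block H G c) (bs : List (Block H G c)) (y : Fin nV) : Set where
    field
      d           : Dart
      ds          : List Dart
      transitions : Linked Transition (d ∷ ds)
      traces      : Traces b bs y d ds

  tracingDarts : ∀ {b bs y} → IsDWalk H G c b bs y → TracingDarts b bs y
  tracingDarts {block s (e ∷ es)} (one joins) with darts-of-block (e ∷ es) joins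
  ... | d ∷ ds , refl , runs = record
    { d = d ; ds = ds ; transitions = parallel-linked runs
    ; traces = record
      { edges≡ = Listₚ.++-identityʳ _ ; start≡ = sym (proj₁ (All.head runs)) ; firstEdge≡ = refl
      ; final≡ = sym (proj₂ (All.lookup runs (lastOf-∈ d ds)))
      ; lastEdge≡ = last-∷-map edgeOf d ds
      ; second≡ = sym (proj₂ (All.head runs)) } }
  tracingDarts {block s (e ∷ es)} {b′ ∷ bs} (cons joins adj walk) with darts-of-block (e ∷ es) joins
  ... | d ∷ ds , refl , runs = record
    { d = d ; ds = ds ++ R.d ∷ R.ds
    ; transitions = Linked-++ (parallel-linked runs) (inj₁ (trans meets R.start≡ , adj′)) R.transitions
    ; traces = record
      { edges≡ = cong (edgeOf d ∷_)
                   (trans (cong (map edgeOf ds ++_) R.edges≡) (sym (Listₚ.map-++ edgeOf ds _)))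
      ; start≡ = sym (proj₁ (All.head runs)) ; firstEdge≡ = refl
      ; final≡ = trans R.final≡ (cong target (sym (lastOf-++ d ds R.d R.ds)))
      ; lastEdge≡ = trans R.lastEdge≡ (cong edgeOf (sym (lastOf-++ d ds R.d R.ds)))
      ; second≡ = sym (proj₂ (All.head runs)) } }
    where
    module R where
      open TracingDarts (tracingDarts walk) public
      open Traces traces public
    meets : target (lastOf d ds) ≡ start b′
    meets = proj₂ (All.lookup runs (lastOf-∈ d ds))
    adj′ : Adj (c (edgeOf (lastOf d ds))) (c (edgeOf R.d))
    adj′ = subst₂ (λ g g′ → Adj (c g) (c g′)) (last-∷-map edgeOf d ds) R.firstEdge≡ adj

  Linked-Transition⇒Follows : ∀ {d ds} → Unique (map edgeOf (d ∷ ds)) →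
                              Linked Transition (d ∷ ds) → Linked Follows (d ∷ ds)
  Linked-Transition⇒Follows _              [-]      = [-]
  Linked-Transition⇒Follows (d∉ ∷ unique) (t ∷ ts) =
    Transition⇒Follows (All.head d∉) t ∷ Linked-Transition⇒Follows unique ts

  closing-edge-distinct : ∀ d ds → Unique (map edgeOf (d ∷ ds)) → target (lastOf d ds) ≡ origin d →
                          edgeOf (lastOf d ds) ≢ edgeOf d
  closing-edge-distinct d []         _         t≡o = ⊥-elim (origin≢target d (sym t≡o))
  closing-edge-distinct d (d′ ∷ ds) (d∉ ∷ _) _   = All.lookup d∉ (∈-map⁺ edgeOf (lastOf-∈ d′ ds)) ∘ sym

  Follows-of-IsClosed : ∀ {b bs y d ds} → Unique (map edgeOf (d ∷ ds)) → Traces b bs y d ds →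
                        IsClosed H G c b bs y → Follows (lastOf d ds) d
  Follows-of-IsClosed {d = d} {ds} unique tr (inj₁ (start≡final , adj)) =
    Transition⇒Follows (closing-edge-distinct d ds unique t≡o)
      (inj₁ (t≡o , subst₂ (λ g g′ → Adj (c g) (c g′)) lastEdge≡ firstEdge≡ adj))
    where
    open Traces tr
    t≡o = trans (sym final≡) (trans (sym start≡final) start≡)
  Follows-of-IsClosed {d = d} {ds} unique tr (inj₂ (second≡final , parallel)) =
    Transition⇒Follows (proj₁ parallel′) (inj₂ (t≢o , proj₂ parallel′))
    where
    open Traces tr
    parallel′ = subst₂ (Parallel H G c) lastEdge≡ firstEdge≡ parallel
    t≢o : target (lastOf d ds) ≢ origin d
    t≢o t≡o = origin≢target d (sym (trans (sym second≡) (trans second≡final (trans final≡ t≡o))))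

  dartCycle-of-closedTrail : (T : ClosedDTrail H G c) → ∃ λ C → cycleEdges C ≡ trailEdges H G c T
  dartCycle-of-closedTrail T =
    record { darts = d ∷ ds
           ; follows = cyclic (Linked-Transition⇒Follows unique transitions) (Follows-of-IsClosed unique traces closed)
           ; edges-unique = unique } , sym edges≡
    where
    open ClosedDTrail T
    open TracingDarts (tracingDarts walk)
    open Traces traces
    unique = subst Unique edges≡ trail

  -- Perfect matchings and partitions into dart cycles

  record DartCyclePartition : Set where
    field
      cycles    : List DartCycle
      partition : concatMap cycleEdges cycles ↭ allFin nE

  dartCyclePartition-of : ClosedDTrailPartition H G c → DartCyclePartition
  dartCyclePartition-of P = record
    { cycles    = map (proj₁ ∘ dartCycle-of-closedTrail) trails
    ; partition = subst (_↭ allFin nE)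
                    (sym (concatMap-map-≗ _ (proj₂ ∘ dartCycle-of-closedTrail) trails)) partition }
    where
    open ClosedDTrailPartition P

  closedDTrailPartition-of : DartCyclePartition → ClosedDTrailPartition H G c
  closedDTrailPartition-of P = record
    { trails    = map (proj₁ ∘ closedTrail-of-dartCycle) cycles
    ; partition = subst (_↭ allFin nE)
                    (sym (concatMap-map-≗ _ (proj₂ ∘ closedTrail-of-dartCycle) cycles)) partition }
    where
    open DartCyclePartition P

  closedDTrailPartition⇔dartCyclePartition : ClosedDTrailPartition H G c ⇔ DartCyclePartition
  closedDTrailPartition⇔dartCyclePartition = mk⇔ dartCyclePartition-of closedDTrailPartition-of

  module FromMatching (PM : PerfectMatching (L2minusMJ H G c)) where
    open PerfectMatching PM

    partner : Dart → Dart
    partner p = proj₁ (cover p)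

    partner-matched : ∀ p → M p (partner p)
    partner-matched p = proj₁ (proj₂ (cover p))

    partner-involutive : ∀ p → partner (partner p) ≡ p
    partner-involutive p = sym (proj₂ (proj₂ (cover (partner p))) p (M-sym (partner-matched p)))

    partner-fixedPointFree : ∀ p → partner p ≢ p
    partner-fixedPointFree p eq =
      L2Adj-irreflexive (proj₁ (subst (L2minusMJ H G c p) eq (M⊆A (partner-matched p))))

    open TwoInvolutions dart↣Fin opposite partner
           opposite-involutive partner-involutive opposite-fixedPointFree partner-fixedPointFree

    Follows-τ : ∀ d → Follows d (τ d)
    Follows-τ d = M⊆A (partner-matched (opposite d))

    orbit-edges-unique : ∀ d → Unique (map edgeOf (orbit d))
    orbit-edges-unique d = subst Unique (sym (Listₚ.map-applyUpTo (λ i → (τ ^ i) d) edgeOf (period d)))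
      (Uniqueₚ.applyUpTo⁺₁ (λ i → edgeOf ((τ ^ i) d)) (period d) λ {i} {j} i<j j<p same →
        [ orbit-injective d i<j j<p , τ^≢ι∘τ^ j i d ] (same-edge same))

    orbitCycle : Dart → DartCycle
    orbitCycle d = record
      { darts = orbit d
      ; follows = Cyclic-map (λ {a} τa≡b → subst (Follows a) τa≡b (Follows-τ a)) (orbit-cyclic d)
      ; edges-unique = orbit-edges-unique d }

    edgeClass : Fin nE → List (Fin nE)
    edgeClass e = cycleEdges (orbitCycle (e , false))

    edgeClass-unique : ∀ e → Unique (edgeClass e)
    edgeClass-unique e = DartCycle.edges-unique (orbitCycle (e , false))

    ∈-edgeClass : ∀ e → e ∈ edgeClass e
    ∈-edgeClass e = here refl

    edgeClass-overlap : ∀ {e e′ g} → g ∈ edgeClass e → g ∈ edgeClass e′ → e ∈ edgeClass e′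
    edgeClass-overlap g∈ g∈′ with ∈-map⁻ edgeOf g∈ | ∈-map⁻ edgeOf g∈′
    ... | p , p∈ , refl | q , q∈ , same with same-edge {p} {q} same
    ... | inj₁ refl = ∈-map⁺ edgeOf (orbit-⊆ p∈ q∈)
    ... | inj₂ refl = ∈-map⁺ edgeOf (orbit-meets-ι p∈ (subst (_∈ _) (sym (opposite-involutive q)) q∈))

    open Representatives Finₚ._≟_ edgeClass edgeClass-unique ∈-edgeClass edgeClass-overlap

    dartCyclePartition : DartCyclePartition
    dartCyclePartition with representatives (allFin nE)
    ... | S , unique , covers = record
      { cycles    = map (orbitCycle ∘ (_, false)) S
      ; partition = subst (_↭ allFin nE) (sym (Listₚ.concatMap-map cycleEdges (orbitCycle ∘ (_, false)) S))
                      (Unique∧complete⇒↭allFin unique (covers (∈-allFin _))) }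

  module Transversal {T : List Dart} (edges↭ : map edgeOf T ↭ allFin nE) where

    edges-unique : Unique (map edgeOf T)
    edges-unique = Unique-resp-↭ (↭-sym edges↭) (Uniqueₚ.allFin⁺ nE)

    unique : Unique T
    unique = Uniqueₚ.map⁻ edges-unique

    opposites-unique : Unique (map opposite T)
    opposites-unique = Uniqueₚ.map⁺ opposite-injective unique

    opposite∉ : ∀ {p} → p ∈ map opposite T → ¬ p ∈ T
    opposite∉ p∈ p∈T with ∈-map⁻ opposite p∈
    ... | t , t∈ , refl = opposite-fixedPointFree t (Unique-map⇒injective edgeOf edges-unique p∈T t∈ refl)

    complete : ∀ p → p ∈ map opposite T ⊎ p ∈ T
    complete p with ∈-map⁻ edgeOf (Permₚ.∈-resp-↭ (↭-sym edges↭) (∈-allFin (edgeOf p)))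
    ... | t , t∈ , same with same-edge {p} {t} same
    ... | inj₁ refl = inj₂ t∈
    ... | inj₂ refl = inj₁ (∈-map⁺ opposite t∈)

  module FromDartCycles (P : DartCyclePartition) where
    open DartCyclePartition P

    steps : List (Dart × Dart)
    steps = concatMap (cyclicPairs ∘ DartCycle.darts) cycles

    exits≡darts : map proj₁ steps ≡ concatMap DartCycle.darts cycles
    exits≡darts = trans (Listₚ.map-concatMap proj₁ _ cycles)
                        (Listₚ.concatMap-cong (map-proj₁-cyclicPairs ∘ DartCycle.darts) cycles)

    entries↭exits : map proj₂ steps ↭ map proj₁ steps
    entries↭exits = subst₂ _↭_ (sym (Listₚ.map-concatMap proj₂ _ cycles)) (sym exits≡darts)
                      (concatMap-↭ (map-proj₂-cyclicPairs ∘ DartCycle.darts) cycles)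

    exitEdges↭ : map edgeOf (map proj₁ steps) ↭ allFin nE
    exitEdges↭ = subst (_↭ allFin nE)
      (sym (trans (cong (map edgeOf) exits≡darts) (Listₚ.map-concatMap edgeOf _ cycles))) partition

    steps-follow : All (uncurry Follows) steps
    steps-follow =
      Allₚ.concat⁺ (Allₚ.map⁺ (All.universal (Cyclic⇒All-cyclicPairs ∘ DartCycle.follows) cycles))

    matchingPairs : List (Dart × Dart)
    matchingPairs = map (map₁ opposite) steps

    firsts≡ : map proj₁ matchingPairs ≡ map opposite (map proj₁ steps)
    firsts≡ = trans (sym (Listₚ.map-∘ steps)) (Listₚ.map-∘ steps)

    seconds≡ : map proj₂ matchingPairs ≡ map proj₂ steps
    seconds≡ = sym (Listₚ.map-∘ steps)

    open Transversal exitEdges↭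

    firsts-unique : Unique (map proj₁ matchingPairs)
    firsts-unique = subst Unique (sym firsts≡) opposites-unique

    seconds-unique : Unique (map proj₂ matchingPairs)
    seconds-unique = subst Unique (sym seconds≡) (Unique-resp-↭ (↭-sym entries↭exits) unique)

    firsts-disjoint : ∀ {p} → p ∈ map proj₁ matchingPairs → ¬ p ∈ map proj₂ matchingPairs
    firsts-disjoint p∈ p∈′ =
      opposite∉ (subst (_ ∈_) firsts≡ p∈) (Permₚ.∈-resp-↭ entries↭exits (subst (_ ∈_) seconds≡ p∈′))

    matchingPairs-complete : ∀ p → p ∈ map proj₁ matchingPairs ⊎ p ∈ map proj₂ matchingPairs
    matchingPairs-complete p = Sum.map (subst (p ∈_) (sym firsts≡))
      (subst (p ∈_) (sym seconds≡) ∘ Permₚ.∈-resp-↭ (↭-sym entries↭exits)) (complete p)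

    open PairsMatching L2minusMJ-sym matchingPairs (Allₚ.map⁺ steps-follow)
      firsts-unique seconds-unique firsts-disjoint matchingPairs-complete public

  perfectMatching⇔dartCyclePartition : PerfectMatching (L2minusMJ H G c) ⇔ DartCyclePartition
  perfectMatching⇔dartCyclePartition = mk⇔ FromMatching.dartCyclePartition FromDartCycles.perfectMatching

theorem6 : (H : GraphWithLoops) (G : LooplessMultigraph)
           (c : Fin (LooplessMultigraph.nE G) → GraphWithLoops.V H) →
           PerfectMatching (L2minusMJ H G c) ⇔ ClosedDTrailPartition H G c
theorem6 H G c = ⇔.trans (perfectMatching⇔dartCyclePartition H G c)
                         (⇔.sym (closedDTrailPartition⇔dartCyclePartition H G c))
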